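{- For all integers $d\geq 4$, $k\geq 3$ and $\Delta\geq 2d$ there is a graph with average degree at most $d$, maximum degree at most $\Delta$, diameter at most $k$, and at least $\frac{d}{8}\left\lfloor\frac{\Delta}{4}\right\rfloor^{k-1}$ vertices. -}

module Defs where

open import Data.Nat using (ℕ; zero; suc; _+_; _*_; _∸_; _^_; _≤_; _/_)
open import Data.Bool using (Bool; true; false)
open import Data.Fin using (Fin)
open import Data.List using (List; length; filterᵇ; map)
open import Data.Nat.ListAction using (sum)
open import Data.Product using (Σ; _×_)
open import Data.List.Base using (allFin)
open import Relation.Binary.PropositionalEquality using (_≡_)

record Graph (n : ℕ) : Set where
  field
    adj   : Fin n → Fin n → Bool
    sym   : ∀ u v → adj u v ≡ adj v u
    irrefl : ∀ v → adj v v ≡ false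

open Graph public

degree : ∀ {n} → Graph n → Fin n → ℕ
degree {n} G v = length (filterᵇ (adj G v) (allFin n))

degreeSum : ∀ {n} → Graph n → ℕ
degreeSum {n} G = sum (map (degree G) (allFin n))

-- average degree at most d  (degreeSum / n ≤ d, written without division)
AvgDegreeAtMost : ∀ {n} → Graph n → ℕ → Set
AvgDegreeAtMost {n} G d = degreeSum G ≤ d * n

MaxDegreeAtMost : ∀ {n} → Graph n → ℕ → Set
MaxDegreeAtMost {n} G Δ = ∀ v → degree G v ≤ Δ

data Walk {n} (G : Graph n) : ℕ → Fin n → Fin n → Set where
  here : ∀ {v} → Walk G zero v v
  step : ∀ {m u w v} → adj G u w ≡ true → Walk G m w v → Walk G (suc m) u v

DistAtMost : ∀ {n} → Graph n → ℕ → Fin n → Fin n → Set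
DistAtMost G k u v = Σ ℕ (λ m → m ≤ k × Walk G m u v)

DiameterAtMost : ∀ {n} → Graph n → ℕ → Set
DiameterAtMost {n} G k = ∀ u v → DistAtMost G k u v

module Submission where

-- Put q = ⌊Δ/4⌋, t = ⌊(d − 3)/6⌋ + 1 and m = k − 2.  For every word w of length m over an
-- alphabet of size q take a layer consisting of a t × t grid of hubs, whose rows are cliques,
-- and r leaves in each grid cell, adjacent to the hubs of that cell's row and column.  Hubs in
-- the same cell of different layers are joined along the de Bruijn shift w ↦ w₂…wₘc, so m
-- shifts reach any word; two vertices are therefore at distance at most 1 + m + 1 = k.
-- Hubs have degree 2q + (t − 1) + (2t − 1)r and leaves 2t − 1.  Taking r to be the quotient of
-- 2q − (t − 1) by 2t − 1 makes the hub degree at most 4q ≤ Δ; the r leaves per hub keep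
-- the average degree at most 3(2t − 1) ≤ d; and t²(r + 1) ≥ dq/8, so the order t²(r + 1)qᵐ is
-- at least (d/8)qᵐ⁺¹.

open import Defs hiding (sym)
open import Function using (_∘_; id)
open import Function.Bundles using (Inverse; _↔_; mk↔ₛ′; mk⇔)
open import Function.Properties.Inverse using (↔-refl; ↔-trans)
open import Data.Bool using (true; T)
open import Data.Empty using (⊥-elim)
open import Data.Product using (Σ; _×_; _,_; ∃₂; proj₁; proj₂; uncurry)
open import Data.Product.Function.NonDependent.Propositional using (_×-↔_)
import Data.Product.Properties as Product
open import Data.Sum using (_⊎_; inj₁; inj₂)
import Data.Sum
open import Data.Sum.Function.Propositional using (_⊎-↔_)
import Data.Sum.Properties as Sum
open import Data.Nat using (ℕ; zero; suc; _+_; _*_; _∸_; _^_; _≤_; _<_; _/_; _%_; z≤n; s≤s; s≤s⁻¹; NonZero)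
open import Data.Nat.Properties
open import Data.Nat.DivMod using (m≡m%n+[m/n]*n; m%n<n; m/n*n≤m)
open import Data.Nat.ListAction using (sum)
open import Data.Nat.Tactic.RingSolver using (solve-∀; solve)
open import Data.Fin using (Fin; zero; suc; _↑ˡ_; _↑ʳ_; punchIn)
open import Data.Fin.Properties using (+↔⊎; *↔×; splitAt-↑ˡ; splitAt-↑ʳ; punchIn-punchOut; punchInᵢ≢i)
import Data.Fin.Properties as Fin
open import Data.List using (List; []; _∷_; [_]; length; map; _++_; tabulate; allFin; filterᵇ; drop; cartesianProductWith)
open import Data.List.Properties using (length-map; length-++; length-tabulate; map-tabulate; ++-assoc; ++-identityʳ)
open import Data.List.Membership.Propositional using (_∈_)
open import Data.List.Membership.Propositional.Properties
  using (∈-map⁺; ∈-map⁻; ∈-++⁺ˡ; ∈-++⁺ʳ; ∈-++⁻; ∈-∃++; ∈-allFin; ∈-filter⁻; ∈-cartesianProductWith⁺)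
open import Data.List.Relation.Binary.Subset.Propositional using (_⊆_)
open import Data.List.Relation.Unary.All using (lookup)
open import Data.List.Relation.Unary.AllPairs using (_∷_)
open import Data.List.Relation.Unary.Any using (here; there)
open import Data.List.Relation.Unary.Unique.Propositional using (Unique)
open import Data.List.Relation.Unary.Unique.Propositional.Properties using (filter⁺; allFin⁺)
open import Data.Vec using (Vec; _∷ʳ_; tail; init; toList; uncons)
open import Data.Vec.Properties using (toList-∷ʳ; toList-injective; length-toList; init-∷ʳ; cast-is-id)
import Data.Vec.Properties as Vec
open import Relation.Binary.Definitions using (DecidableEquality)
open import Relation.Binary.PropositionalEquality hiding ([_])
open import Relation.Nullary using (Dec; yes; no; does; ¬?; _×-dec_; _⊎-dec_)
open import Relation.Nullary.Decidable using (does-⇔; dec-true; dec-false; toWitness; isYes≗does)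

length-++-∷ : ∀ {A : Set} (xs : List A) x ys → length (xs ++ x ∷ ys) ≡ suc (length (xs ++ ys))
length-++-∷ xs x ys = begin
  length (xs ++ x ∷ ys)          ≡⟨ length-++ xs ⟩
  length xs + suc (length ys)    ≡⟨ +-suc (length xs) (length ys) ⟩
  suc (length xs + length ys)    ≡⟨ cong suc (length-++ xs) ⟨
  suc (length (xs ++ ys))        ∎
  where open ≡-Reasoning

Unique-⊆⇒length≤ : ∀ {A : Set} {xs ys : List A} → Unique xs → xs ⊆ ys → length xs ≤ length ys
Unique-⊆⇒length≤ {xs = []} _ _ = z≤n
Unique-⊆⇒length≤ {xs = x ∷ xs} (x∉xs ∷ xs!) xs⊆ys with ∈-∃++ (xs⊆ys (here refl))
... | ys₁ , ys₂ , refl =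
  ≤-trans (s≤s (Unique-⊆⇒length≤ xs! xs⊆ys₁++ys₂)) (≤-reflexive (sym (length-++-∷ ys₁ x ys₂)))
  where
    xs⊆ys₁++ys₂ : xs ⊆ ys₁ ++ ys₂
    xs⊆ys₁++ys₂ z∈xs with ∈-++⁻ ys₁ (xs⊆ys (there z∈xs))
    ... | inj₁ z∈ys₁         = ∈-++⁺ˡ z∈ys₁
    ... | inj₂ (here refl)   = ⊥-elim (lookup x∉xs z∈xs refl)
    ... | inj₂ (there z∈ys₂) = ∈-++⁺ʳ ys₁ z∈ys₂

sum-tabulate-↑ : ∀ m {n} (f : Fin (m + n) → ℕ) →
  sum (tabulate f) ≡ sum (tabulate (f ∘ (_↑ˡ n))) + sum (tabulate (f ∘ (m ↑ʳ_)))
sum-tabulate-↑ zero    f = refl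
sum-tabulate-↑ (suc m) f = trans (cong (f zero +_) (sum-tabulate-↑ m (f ∘ suc))) (sym (+-assoc (f zero) _ _))

sum-tabulate-≤ : ∀ {n c} (f : Fin n → ℕ) → (∀ i → f i ≤ c) → sum (tabulate f) ≤ n * c
sum-tabulate-≤ {zero}  f f≤c = z≤n
sum-tabulate-≤ {suc n} f f≤c = +-mono-≤ (f≤c zero) (sum-tabulate-≤ (f ∘ suc) (f≤c ∘ suc))

∈-map-allFin : ∀ {X : Set} {k} (f : Fin k → X) i → f i ∈ map f (allFin k)
∈-map-allFin f i = ∈-map⁺ f (∈-allFin i)

length-allFin : ∀ k → length (allFin k) ≡ k
length-allFin k = length-tabulate {n = k} id

length-map-allFin : ∀ {X : Set} {k} (f : Fin k → X) → length (map f (allFin k)) ≡ k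
length-map-allFin {k = k} f = trans (length-map f (allFin k)) (length-allFin k)

length-cartesianProductWith : ∀ {X Y Z : Set} (f : X → Y → Z) xs ys →
  length (cartesianProductWith f xs ys) ≡ length xs * length ys
length-cartesianProductWith f []       ys = refl
length-cartesianProductWith f (x ∷ xs) ys = begin
  length (map (f x) ys ++ cartesianProductWith f xs ys)        ≡⟨ length-++ (map (f x) ys) ⟩
  length (map (f x) ys) + length (cartesianProductWith f xs ys)
    ≡⟨ cong₂ _+_ (length-map (f x) ys) (length-cartesianProductWith f xs ys) ⟩
  length ys + length xs * length ys                             ∎
  where open ≡-Reasoning

degreeSum-≤ : ∀ {a b c₁ c₂} (G : Graph (a + b)) →
  (∀ i → degree G (i ↑ˡ b) ≤ c₁) → (∀ j → degree G (a ↑ʳ j) ≤ c₂) → degreeSum G ≤ a * c₁ + b * c₂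
degreeSum-≤ {a} {b} {c₁} {c₂} G left≤ right≤ = begin
  degreeSum G                                     ≡⟨ cong sum (map-tabulate id (degree G)) ⟩
  sum (tabulate (degree G))                       ≡⟨ sum-tabulate-↑ a (degree G) ⟩
  sum (tabulate (degree G ∘ (_↑ˡ b))) + sum (tabulate (degree G ∘ (a ↑ʳ_)))
    ≤⟨ +-mono-≤ (sum-tabulate-≤ _ left≤) (sum-tabulate-≤ _ right≤) ⟩
  a * c₁ + b * c₂                                 ∎
  where open ≤-Reasoning

module _ {n} {G : Graph n} where

  walk-++ : ∀ {a b u v w} → Walk G a u v → Walk G b v w → Walk G (a + b) u w
  walk-++ here         q = q
  walk-++ (step e p)   q = step e (walk-++ p q)

  dist-refl : ∀ {u} → DistAtMost G 0 u u
  dist-refl = 0 , z≤n , here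

  dist-mono : ∀ {a b u v} → a ≤ b → DistAtMost G a u v → DistAtMost G b u v
  dist-mono a≤b (m , m≤a , p) = m , ≤-trans m≤a a≤b , p

  infixr 5 _▹_
  _▹_ : ∀ {a b u v w} → DistAtMost G a u v → DistAtMost G b v w → DistAtMost G (a + b) u w
  (m₁ , m₁≤a , p) ▹ (m₂ , m₂≤b , q) = m₁ + m₂ , +-mono-≤ m₁≤a m₂≤b , walk-++ p q

-- Graphs presented by out-neighbour lists

module OutListGraph {A : Set} {n : ℕ} (enc : Fin n ↔ A) (_≟_ : DecidableEquality A) (out : A → List A) where

  open Inverse enc using (to; from; strictlyInverseˡ; strictlyInverseʳ)
  open import Data.List.Membership.DecPropositional _≟_ using (_∈?_)

  Linked : A → A → Set
  Linked x y = y ∈ out x ⊎ x ∈ out y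

  Adjacent : A → A → Set
  Adjacent x y = Linked x y × x ≢ y

  Adjacent? : ∀ x y → Dec (Adjacent x y)
  Adjacent? x y = (y ∈? out x ⊎-dec x ∈? out y) ×-dec ¬? (x ≟ y)

  graph : Graph n
  graph = record
    { adj    = λ i j → does (Adjacent? (to i) (to j))
    ; sym    = λ i j → does-⇔ (mk⇔ flip flip) (Adjacent? (to i) (to j)) (Adjacent? (to j) (to i))
    ; irrefl = λ i → dec-false (Adjacent? (to i) (to i)) (λ (_ , x≢x) → x≢x refl)
    }
    where
      flip : ∀ {x y} → Adjacent x y → Adjacent y x
      flip (linked , x≢y) = Data.Sum.swap linked , x≢y ∘ sym

  neighbour-adjacent : ∀ {i j} → j ∈ filterᵇ (adj graph i) (allFin n) → Adjacent (to i) (to j)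
  neighbour-adjacent {i} {j} j∈ =
    toWitness (subst T (sym (isYes≗does (Adjacent? (to i) (to j)))) (proj₂ (∈-filter⁻ _ {xs = allFin n} j∈)))

  module _ (candidates : A → List A) (complete : ∀ x y → Linked x y → y ∈ candidates x) where

    degree-≤ : ∀ i → degree graph i ≤ length (candidates (to i))
    degree-≤ i = begin
      degree graph i                       ≤⟨ Unique-⊆⇒length≤ (filter⁺ _ (allFin⁺ n)) neighbours⊆ ⟩
      length (map from (candidates (to i))) ≡⟨ length-map from (candidates (to i)) ⟩
      length (candidates (to i))           ∎
      where
        open ≤-Reasoning
        neighbours⊆ : filterᵇ (adj graph i) (allFin n) ⊆ map from (candidates (to i))
        neighbours⊆ {j} j∈ = subst (_∈ map from (candidates (to i))) (strictlyInverseʳ j)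
          (∈-map⁺ from (complete (to i) (to j) (proj₁ (neighbour-adjacent j∈))))

  Near : ℕ → A → A → Set
  Near ℓ x y = DistAtMost graph ℓ (from x) (from y)

  near-linked : ∀ {x y} → Linked x y → Near 1 x y
  near-linked {x} {y} linked with x ≟ y
  ... | yes refl = dist-mono z≤n dist-refl
  ... | no x≢y   = 1 , ≤-refl , step edge here
    where
      edge : adj graph (from x) (from y) ≡ true
      edge = dec-true (Adjacent? (to (from x)) (to (from y)))
        (subst₂ Adjacent (sym (strictlyInverseˡ x)) (sym (strictlyInverseˡ y)) (linked , x≢y))

  near-out : ∀ x y → y ∈ out x → Near 1 x y
  near-out x y = near-linked ∘ inj₁

  near-in : ∀ x y → x ∈ out y → Near 1 x y
  near-in x y = near-linked ∘ inj₂

  diameter-≤ : ∀ {ℓ} → (∀ x y → Near ℓ x y) → DiameterAtMost graph ℓ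
  diameter-≤ {ℓ} near i j =
    subst₂ (DistAtMost graph ℓ) (strictlyInverseʳ i) (strictlyInverseʳ j) (near (to i) (to j))

-- Words and the de Bruijn shift

module _ {A : Set} where

  open import Data.Vec using ([]; _∷_)

  ∷-↔ : ∀ {m} → (A × Vec A m) ↔ Vec A (suc m)
  ∷-↔ = mk↔ₛ′ (uncurry _∷_) uncons (λ { (x ∷ xs) → refl }) (λ _ → refl)

  ^↔Vec : ∀ {a} → Fin a ↔ A → ∀ m → Fin (a ^ m) ↔ Vec A m
  ^↔Vec alphabet zero    = mk↔ₛ′ (λ _ → []) (λ _ → zero) (λ { [] → refl }) (λ { zero → refl })
  ^↔Vec alphabet (suc m) = ↔-trans *↔× (↔-trans (alphabet ×-↔ ^↔Vec alphabet m) ∷-↔)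

  shift : ∀ {m} → Vec A m → A → Vec A m
  shift w c = tail (w ∷ʳ c)

  shifts : ∀ {m k} → Vec A m → Vec A k → Vec A m
  shifts w []       = w
  shifts w (c ∷ cs) = shifts (shift w c) cs

  toList-shift : ∀ {m} (w : Vec A m) c → toList (shift w c) ≡ drop 1 (toList w ++ [ c ])
  toList-shift []       c = refl
  toList-shift (x ∷ xs) c = toList-∷ʳ c xs

  toList-shifts : ∀ {m k} (us vs : List A) (w : Vec A m) (cs : Vec A k) →
    toList w ≡ us ++ vs → length us ≡ k → toList (shifts w cs) ≡ vs ++ toList cs
  toList-shifts []       vs w []       w≡vs _   = trans w≡vs (sym (++-identityʳ vs))
  toList-shifts (u ∷ us) vs w (c ∷ cs) w≡u∷us++vs |us|≡ = begin
    toList (shifts (shift w c) cs)   ≡⟨ toList-shifts us (vs ++ [ c ]) (shift w c) cs shifted (suc-injective |us|≡) ⟩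
    (vs ++ [ c ]) ++ toList cs       ≡⟨ ++-assoc vs [ c ] (toList cs) ⟩
    vs ++ c ∷ toList cs              ∎
    where
      open ≡-Reasoning
      shifted : toList (shift w c) ≡ us ++ (vs ++ [ c ])
      shifted = begin
        toList (shift w c)            ≡⟨ toList-shift w c ⟩
        drop 1 (toList w ++ [ c ])    ≡⟨ cong (λ l → drop 1 (l ++ [ c ])) w≡u∷us++vs ⟩
        (us ++ vs) ++ [ c ]           ≡⟨ ++-assoc us vs [ c ] ⟩
        us ++ (vs ++ [ c ])           ∎

  shifts-overwrite : ∀ {m} (w w′ : Vec A m) → shifts w w′ ≡ w′
  shifts-overwrite w w′ = trans (sym (cast-is-id refl (shifts w w′))) (toList-injective refl (shifts w w′) w′
    (toList-shifts (toList w) [] w w′ (sym (++-identityʳ (toList w))) (length-toList w)))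

  init-∷-shift : ∀ {m} (w : Vec A m) c → Σ A λ c′ → init (c′ ∷ shift w c) ≡ w
  init-∷-shift []       c = c , refl
  init-∷-shift (x ∷ xs) c = x , cong (x ∷_) (init-∷ʳ c xs)

hubDegree : ℕ → ℕ → ℕ → ℕ
hubDegree q t′ r = (q + t′) + (q + (suc t′ * r + t′ * r))

leafDegree : ℕ → ℕ
leafDegree t′ = suc t′ + t′

module Gadget (q t′ r₀ m : ℕ) where

  open import Data.Vec using ([]; _∷_)

  t r N : ℕ
  t = suc t′
  r = suc r₀
  N = t * (t * q ^ m)

  Word Cell Vertex : Set
  Word   = Vec (Fin q) m
  Cell   = Fin t × Fin t × Word
  Vertex = Cell ⊎ Fin r × Cell

  -- hub a b w is the hub in column a and row b of layer w; leaf j a b w is the j-th leaf there.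
  pattern hub a b w    = inj₁ (a , b , w)
  pattern leaf j a b w = inj₂ (j , a , b , w)

  others : Fin t → List (Fin t)
  others a = map (punchIn a) (allFin t′)

  ∈-others : ∀ {a b} → b ≢ a → b ∈ others a
  ∈-others {a} b≢a = subst (_∈ others a) (punchIn-punchOut (b≢a ∘ sym)) (∈-map-allFin (punchIn a) _)

  ∈-others⁻ : ∀ {a b} → b ∈ others a → b ≢ a
  ∈-others⁻ {a} b∈ with i , _ , refl ← ∈-map⁻ (punchIn a) b∈ = punchInᵢ≢i a i

  others-sym : ∀ {a b} → b ∈ others a → a ∈ others b
  others-sym b∈ = ∈-others (∈-others⁻ b∈ ∘ sym)

  predecessors : Word → List Word
  predecessors w = map (λ c → init (c ∷ w)) (allFin q)

  ∈-predecessors-shift : ∀ w c → w ∈ predecessors (shift w c)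
  ∈-predecessors-shift w c with c′ , eq ← init-∷-shift w c =
    subst (_∈ predecessors (shift w c)) eq (∈-map-allFin (λ c″ → init (c″ ∷ shift w c)) c′)

  -- Edges are the pairs {x, y} with y ∈ out x; the lists out x ++ into x cover all neighbours of x.
  out : Vertex → List Vertex
  out (hub a b w)    = map (λ c → hub a b (shift w c)) (allFin q) ++ map (λ a′ → hub a′ b w) (others a)
  out (leaf j a b w) = map (λ b′ → hub a b′ w) (allFin t) ++ map (λ a′ → hub a′ b w) (others a)

  into : Vertex → List Vertex
  into (hub a b w)    = map (λ v → hub a b v) (predecessors w) ++
                          (cartesianProductWith (λ b′ j → leaf j a b′ w) (allFin t) (allFin r) ++
                           cartesianProductWith (λ a′ j → leaf j a′ b w) (others a) (allFin r))
  into (leaf _ _ _ _) = []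

  candidates : Vertex → List Vertex
  candidates x = out x ++ into x

  into-complete : ∀ {x y} → x ∈ out y → y ∈ candidates x
  into-complete {y = hub a b w} x∈ with ∈-++⁻ (map (λ c → hub a b (shift w c)) (allFin q)) x∈
  ... | inj₁ x∈ with c , _ , refl ← ∈-map⁻ (λ c → hub a b (shift w c)) x∈ =
    ∈-++⁺ʳ (out (hub a b (shift w c))) (∈-++⁺ˡ (∈-map⁺ (λ v → hub a b v) (∈-predecessors-shift w c)))
  ... | inj₂ x∈ with a′ , a′∈ , refl ← ∈-map⁻ (λ a′ → hub a′ b w) x∈ =
    ∈-++⁺ˡ (∈-++⁺ʳ (map (λ c → hub a′ b (shift w c)) (allFin q))
      (∈-map⁺ (λ a″ → hub a″ b w) (others-sym a′∈)))
  into-complete {y = leaf j a b w} x∈ with ∈-++⁻ (map (λ b′ → hub a b′ w) (allFin t)) x∈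
  ... | inj₁ x∈ with b′ , _ , refl ← ∈-map⁻ (λ b′ → hub a b′ w) x∈ =
    ∈-++⁺ʳ (out (hub a b′ w)) (∈-++⁺ʳ (map (λ v → hub a b′ v) (predecessors w))
      (∈-++⁺ˡ (∈-cartesianProductWith⁺ (λ b″ j → leaf j a b″ w) (∈-allFin b) (∈-allFin j))))
  ... | inj₂ x∈ with a′ , a′∈ , refl ← ∈-map⁻ (λ a′ → hub a′ b w) x∈ =
    ∈-++⁺ʳ (out (hub a′ b w)) (∈-++⁺ʳ (map (λ v → hub a′ b v) (predecessors w))
      (∈-++⁺ʳ (cartesianProductWith (λ b′ j → leaf j a′ b′ w) (allFin t) (allFin r))
        (∈-cartesianProductWith⁺ (λ a″ j → leaf j a″ b w) (others-sym a′∈) (∈-allFin j))))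

  candidates-complete : ∀ x y → y ∈ out x ⊎ x ∈ out y → y ∈ candidates x
  candidates-complete x y (inj₁ y∈) = ∈-++⁺ˡ y∈
  candidates-complete x y (inj₂ x∈) = into-complete x∈

  length-others : ∀ a → length (others a) ≡ t′
  length-others a = length-map-allFin (punchIn a)

  length-out-hub : ∀ a b w → length (out (hub a b w)) ≡ q + t′
  length-out-hub a b w = trans (length-++ (map (λ c → hub a b (shift w c)) (allFin q)))
    (cong₂ _+_ (length-map-allFin _) (trans (length-map _ (others a)) (length-others a)))

  length-into-hub : ∀ a b w → length (into (hub a b w)) ≡ q + (t * r + t′ * r)
  length-into-hub a b w = begin
    length (into (hub a b w))
      ≡⟨ length-++ (map (λ v → hub a b v) (predecessors w)) ⟩
    length (map (λ v → hub a b v) (predecessors w)) + length (column ++ row)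
      ≡⟨ cong₂ _+_ (trans (length-map _ (predecessors w)) (length-map-allFin _)) (length-++ column) ⟩
    q + (length column + length row)
      ≡⟨ cong (q +_) (cong₂ _+_ length-column length-row) ⟩
    q + (t * r + t′ * r) ∎
    where
      open ≡-Reasoning
      column row : List Vertex
      column = cartesianProductWith (λ b′ j → leaf j a b′ w) (allFin t) (allFin r)
      row    = cartesianProductWith (λ a′ j → leaf j a′ b w) (others a) (allFin r)
      length-column : length column ≡ t * r
      length-column = trans (length-cartesianProductWith _ (allFin t) (allFin r))
        (cong₂ _*_ (length-allFin t) (length-allFin r))
      length-row : length row ≡ t′ * r
      length-row = trans (length-cartesianProductWith _ (others a) (allFin r))
        (cong₂ _*_ (length-others a) (length-allFin r))

  length-candidates-hub : ∀ c → length (candidates (inj₁ c)) ≡ hubDegree q t′ r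
  length-candidates-hub (a , b , w) =
    trans (length-++ (out (hub a b w))) (cong₂ _+_ (length-out-hub a b w) (length-into-hub a b w))

  length-candidates-leaf : ∀ c → length (candidates (inj₂ c)) ≡ leafDegree t′
  length-candidates-leaf (j , a , b , w) = begin
    length (out (leaf j a b w) ++ [])                    ≡⟨ cong length (++-identityʳ (out (leaf j a b w))) ⟩
    length (out (leaf j a b w))                          ≡⟨ length-++ (map (λ b′ → hub a b′ w) (allFin t)) ⟩
    length (map (λ b′ → hub a b′ w) (allFin t)) + length (map (λ a′ → hub a′ b w) (others a))
      ≡⟨ cong₂ _+_ (length-map-allFin _) (trans (length-map _ (others a)) (length-others a)) ⟩
    t + t′                                               ∎
    where open ≡-Reasoning

  _≟ᵛ_ : DecidableEquality Vertex
  _≟ᵛ_ = Sum.≡-dec _≟ᶜ_ (Product.≡-dec Fin._≟_ _≟ᶜ_)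
    where
      _≟ᶜ_ : DecidableEquality Cell
      _≟ᶜ_ = Product.≡-dec Fin._≟_ (Product.≡-dec Fin._≟_ (Vec.≡-dec Fin._≟_))

  cell↔ : Fin N ↔ Cell
  cell↔ = ↔-trans *↔× (↔-refl ×-↔ ↔-trans *↔× (↔-refl ×-↔ ^↔Vec ↔-refl m))

  labelledCell↔ : Fin (r * N) ↔ (Fin r × Cell)
  labelledCell↔ = ↔-trans *↔× (↔-refl ×-↔ cell↔)

  vertex↔ : Fin (N + r * N) ↔ Vertex
  vertex↔ = ↔-trans +↔⊎ (cell↔ ⊎-↔ labelledCell↔)

  open OutListGraph vertex↔ _≟ᵛ_ out public
  open Inverse vertex↔ using (to)

  degree-≤-candidates : ∀ i → degree graph i ≤ length (candidates (to i))
  degree-≤-candidates = degree-≤ candidates candidates-complete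

  to-↑ˡ : ∀ i → to (i ↑ˡ r * N) ≡ inj₁ (Inverse.to cell↔ i)
  to-↑ˡ i = cong (Data.Sum.map (Inverse.to cell↔) (Inverse.to labelledCell↔)) (splitAt-↑ˡ N i (r * N))

  to-↑ʳ : ∀ i → to (N ↑ʳ i) ≡ inj₂ (Inverse.to labelledCell↔ i)
  to-↑ʳ i = cong (Data.Sum.map (Inverse.to cell↔) (Inverse.to labelledCell↔)) (splitAt-↑ʳ N (r * N) i)

  degree-hub : ∀ i → degree graph (i ↑ˡ r * N) ≤ hubDegree q t′ r
  degree-hub i = ≤-trans (degree-≤-candidates (i ↑ˡ r * N))
    (≤-reflexive (trans (cong (length ∘ candidates) (to-↑ˡ i))
                        (length-candidates-hub (Inverse.to cell↔ i))))

  degree-leaf : ∀ i → degree graph (N ↑ʳ i) ≤ leafDegree t′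
  degree-leaf i = ≤-trans (degree-≤-candidates (N ↑ʳ i))
    (≤-reflexive (trans (cong (length ∘ candidates) (to-↑ʳ i))
                        (length-candidates-leaf (Inverse.to labelledCell↔ i))))

  maxDegree : ∀ {Δ} → hubDegree q t′ r ≤ Δ → leafDegree t′ ≤ Δ → MaxDegreeAtMost graph Δ
  maxDegree {Δ} hub≤Δ leaf≤Δ i = ≤-trans (degree-≤-candidates i) (candidates≤Δ (to i))
    where
      candidates≤Δ : ∀ x → length (candidates x) ≤ Δ
      candidates≤Δ (inj₁ c) = ≤-trans (≤-reflexive (length-candidates-hub c)) hub≤Δ
      candidates≤Δ (inj₂ c) = ≤-trans (≤-reflexive (length-candidates-leaf c)) leaf≤Δ

  avgDegree : ∀ {d} → hubDegree q t′ r + r * leafDegree t′ ≤ d * suc r → AvgDegreeAtMost graph d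
  avgDegree {d} average = begin
    degreeSum graph                                     ≤⟨ degreeSum-≤ graph degree-hub degree-leaf ⟩
    N * hubDegree q t′ r + r * N * leafDegree t′        ≡⟨ regroup N (hubDegree q t′ r) r (leafDegree t′) ⟩
    N * (hubDegree q t′ r + r * leafDegree t′)          ≤⟨ *-monoʳ-≤ N average ⟩
    N * (d * suc r)                                     ≡⟨ swap N d (suc r) ⟩
    d * (N + r * N)                                     ∎
    where
      open ≤-Reasoning
      regroup : ∀ N H r L → N * H + r * N * L ≡ N * (H + r * L)
      regroup = solve-∀
      swap : ∀ N d s → N * (d * s) ≡ d * (s * N)
      swap = solve-∀

  hub-row : ∀ a a′ b w → Near 1 (hub a b w) (hub a′ b w)
  hub-row a a′ b w with a′ Fin.≟ a
  ... | yes refl = dist-mono z≤n dist-refl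
  ... | no a′≢a  = near-out (hub a b w) (hub a′ b w)
    (∈-++⁺ʳ (map (λ c → hub a b (shift w c)) (allFin q)) (∈-map⁺ (λ a″ → hub a″ b w) (∈-others a′≢a)))

  hub-shifts : ∀ {k} a b w (cs : Vec (Fin q) k) → Near k (hub a b w) (hub a b (shifts w cs))
  hub-shifts a b w []       = dist-refl
  hub-shifts a b w (c ∷ cs) =
    near-out (hub a b w) (hub a b (shift w c)) (∈-++⁺ˡ (∈-map-allFin (λ c → hub a b (shift w c)) c))
    ▹ hub-shifts a b (shift w c) cs

  hub-word : ∀ a b w w′ → Near m (hub a b w) (hub a b w′)
  hub-word a b w w′ = subst (λ v → Near m (hub a b w) (hub a b v)) (shifts-overwrite w w′) (hub-shifts a b w w′)

  ∈-column : ∀ j a b b′ w → hub a b′ w ∈ out (leaf j a b w)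
  ∈-column j a b b′ w = ∈-++⁺ˡ (∈-map-allFin (λ b′ → hub a b′ w) b′)

  ∈-row : ∀ j a a′ b w → hub a′ b w ∈ out (leaf j a b w)
  ∈-row j a a′ b w with a′ Fin.≟ a
  ... | yes refl = ∈-column j a b b w
  ... | no a′≢a  =
    ∈-++⁺ʳ (map (λ b′ → hub a b′ w) (allFin t)) (∈-map⁺ (λ a″ → hub a″ b w) (∈-others a′≢a))

  leaf→column : ∀ j a b b′ w → Near 1 (leaf j a b w) (hub a b′ w)
  leaf→column j a b b′ w = near-out (leaf j a b w) (hub a b′ w) (∈-column j a b b′ w)

  column→leaf : ∀ j a b b′ w → Near 1 (hub a b′ w) (leaf j a b w)
  column→leaf j a b b′ w = near-in (hub a b′ w) (leaf j a b w) (∈-column j a b b′ w)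

  leaf→row : ∀ j a a′ b w → Near 1 (leaf j a b w) (hub a′ b w)
  leaf→row j a a′ b w = near-out (leaf j a b w) (hub a′ b w) (∈-row j a a′ b w)

  row→leaf : ∀ j a a′ b w → Near 1 (hub a′ b w) (leaf j a b w)
  row→leaf j a a′ b w = near-in (hub a′ b w) (leaf j a b w) (∈-row j a a′ b w)

  -- Two hubs are joined through a leaf, which is why r ≥ 1.
  near : ∀ x y → Near (2 + m) x y
  near (hub a b w) (hub a′ b′ w′) =
    column→leaf zero a b′ b w ▹ leaf→row zero a a′ b′ w ▹ hub-word a′ b′ w w′
  near (leaf j a b w) (hub a′ b′ w′) =
    leaf→column j a b b′ w ▹ hub-row a a′ b′ w ▹ hub-word a′ b′ w w′
  near (hub a b w) (leaf j′ a′ b′ w′) = dist-mono (≤-reflexive (cong suc (+-comm m 1)))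
    (hub-row a a′ b w ▹ hub-word a′ b w w′ ▹ column→leaf j′ a′ b′ b w′)
  near (leaf j a b w) (leaf j′ a′ b′ w′) = dist-mono (≤-reflexive (cong suc (+-comm m 1)))
    (leaf→column j a b b′ w ▹ hub-word a b′ w w′ ▹ row→leaf j′ a′ a b′ w′)

  diameter : DiameterAtMost graph (2 + m)
  diameter = diameter-≤ near

  order-≥ : ∀ {d} → d * q ≤ 8 * (t * t * suc r) → d * q ^ suc m ≤ 8 * (N + r * N)
  order-≥ {d} dq≤ = begin
    d * (q * q ^ m)                ≡⟨ *-assoc d q (q ^ m) ⟨
    d * q * q ^ m                  ≤⟨ *-monoˡ-≤ (q ^ m) dq≤ ⟩
    8 * (t * t * suc r) * q ^ m    ≡⟨ regroup t (suc r) (q ^ m) ⟩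
    8 * (suc r * N)                ∎
    where
      open ≤-Reasoning
      regroup : ∀ t s Q → 8 * (t * t * s) * Q ≡ 8 * (s * (t * (t * Q)))
      regroup = solve-∀

-- Choice of parameters

record Admissible (d Δ q t′ r₀ : ℕ) : Set where
  field
    hub≤Δ   : hubDegree q t′ (suc r₀) ≤ Δ
    leaf≤Δ  : leafDegree t′ ≤ Δ
    average : hubDegree q t′ (suc r₀) + suc r₀ * leafDegree t′ ≤ d * suc (suc r₀)
    order   : d * q ≤ 8 * (suc t′ * suc t′ * suc (suc r₀))

admissible : ∀ {d Δ q t′ r₀ s} → 4 * q ≤ Δ → 2 * d ≤ Δ → 6 * t′ + 3 ≤ d → d ≤ 6 * t′ + 8 →
  q + q ≡ t′ + s + suc r₀ * suc (2 * t′) → s ≤ 2 * t′ → Admissible d Δ q t′ r₀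
admissible {d} {Δ} {q} {t′} {r₀} {s} 4q≤Δ 2d≤Δ d≥ d≤ 2q≡ s≤ = record
  { hub≤Δ   = hub≤Δ
  ; leaf≤Δ  = leaf≤Δ
  ; average = average
  ; order   = order
  }
  where
    open ≤-Reasoning

    hub≤Δ : hubDegree q t′ (suc r₀) ≤ Δ
    hub≤Δ = m+n≤o⇒m≤o (hubDegree q t′ (suc r₀)) (begin
      (q + t′) + (q + (suc t′ * suc r₀ + t′ * suc r₀)) + s
        ≡⟨ solve (q ∷ t′ ∷ r₀ ∷ s ∷ []) ⟩
      (q + q) + (t′ + s + suc r₀ * suc (2 * t′))
        ≡⟨ cong ((q + q) +_) 2q≡ ⟨
      (q + q) + (q + q)
        ≡⟨ solve (q ∷ []) ⟩
      4 * q
        ≤⟨ 4q≤Δ ⟩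
      Δ ∎)

    leaf≤Δ : leafDegree t′ ≤ Δ
    leaf≤Δ = begin
      suc t′ + t′   ≤⟨ m+n≤o⇒m≤o _ {4 * t′ + 2} (≤-reflexive (solve (t′ ∷ []))) ⟩
      6 * t′ + 3    ≤⟨ d≥ ⟩
      d             ≤⟨ m≤n*m d 2 ⟩
      2 * d         ≤⟨ 2d≤Δ ⟩
      Δ             ∎

    average : hubDegree q t′ (suc r₀) + suc r₀ * leafDegree t′ ≤ d * suc (suc r₀)
    average = begin
      (q + t′) + (q + (suc t′ * suc r₀ + t′ * suc r₀)) + suc r₀ * (suc t′ + t′)
        ≡⟨ solve (q ∷ t′ ∷ r₀ ∷ []) ⟩
      (q + q) + (t′ + 2 * (suc r₀ * suc (2 * t′)))
        ≡⟨ cong (_+ (t′ + 2 * (suc r₀ * suc (2 * t′)))) 2q≡ ⟩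
      (t′ + s + suc r₀ * suc (2 * t′)) + (t′ + 2 * (suc r₀ * suc (2 * t′)))
        ≤⟨ +-monoˡ-≤ _ (+-monoˡ-≤ (suc r₀ * suc (2 * t′)) (+-monoʳ-≤ t′ s≤)) ⟩
      (t′ + 2 * t′ + suc r₀ * suc (2 * t′)) + (t′ + 2 * (suc r₀ * suc (2 * t′)))
        ≤⟨ m+n≤o⇒m≤o _ {2 * t′ + 3} (≤-reflexive (solve (t′ ∷ r₀ ∷ []))) ⟩
      (6 * t′ + 3) * suc (suc r₀)
        ≤⟨ *-monoˡ-≤ (suc (suc r₀)) d≥ ⟩
      d * suc (suc r₀) ∎

    -- The gap in the last step is a polynomial in t′ and r₀ with nonnegative coefficients;
    -- this is where r ≥ 1 is needed.
    order : d * q ≤ 8 * (suc t′ * suc t′ * suc (suc r₀))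
    order = *-cancelˡ-≤ 2 (begin
      2 * (d * q)
        ≡⟨ solve (d ∷ q ∷ []) ⟩
      d * (q + q)
        ≤⟨ *-monoˡ-≤ (q + q) d≤ ⟩
      (6 * t′ + 8) * (q + q)
        ≡⟨ cong ((6 * t′ + 8) *_) 2q≡ ⟩
      (6 * t′ + 8) * (t′ + s + suc r₀ * suc (2 * t′))
        ≤⟨ *-monoʳ-≤ (6 * t′ + 8) (+-monoˡ-≤ (suc r₀ * suc (2 * t′)) (+-monoʳ-≤ t′ s≤)) ⟩
      (6 * t′ + 8) * (t′ + 2 * t′ + suc r₀ * suc (2 * t′))
        ≤⟨ m+n≤o⇒m≤o _ {4 * t′ * t′ * r₀ + 2 * t′ * t′ + 10 * t′ * r₀ + 18 * t′ + 8 * r₀ + 24}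
             (≤-reflexive (solve (t′ ∷ r₀ ∷ []))) ⟩
      2 * (8 * (suc t′ * suc t′ * suc (suc r₀))) ∎)

m<n+[m/n]*n : ∀ m n .{{_ : NonZero n}} → m < n + (m / n) * n
m<n+[m/n]*n m n = begin-strict
  m                       ≡⟨ m≡m%n+[m/n]*n m n ⟩
  m % n + (m / n) * n     <⟨ +-monoˡ-< ((m / n) * n) (m%n<n m n) ⟩
  n + (m / n) * n         ∎
  where open ≤-Reasoning

-- With D = 2t′ + 1, r₀ + 1 is the quotient of 2q − t′ by D.  Dividing B = 2q − t′ − D instead
-- makes the quotient visibly positive; the truncated subtraction is exact as t′ + D ≤ 2q.
choose-r₀ : ∀ {d Δ q t′} → 3 ≤ d → 2 * d ≤ Δ → 4 * q ≤ Δ → Δ < 4 + 4 * q →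
  t′ * 6 ≤ d ∸ 3 → d ∸ 3 < 6 + t′ * 6 → Σ ℕ (Admissible d Δ q t′)
choose-r₀ {d} {Δ} {q} {t′} 3≤d 2d≤Δ 4q≤Δ Δ<4+4q 6t′≤d-3 d-3<6+6t′ =
  B / D , admissible 4q≤Δ 2d≤Δ d≥ d≤ 2q≡ (s≤s⁻¹ (m%n<n B D))
  where
    D B : ℕ
    D = suc (2 * t′)
    B = (q + q) ∸ (t′ + D)

    d≥ : 6 * t′ + 3 ≤ d
    d≥ = begin
      6 * t′ + 3        ≡⟨ cong (_+ 3) (*-comm 6 t′) ⟩
      t′ * 6 + 3        ≤⟨ +-monoˡ-≤ 3 6t′≤d-3 ⟩
      d ∸ 3 + 3         ≡⟨ m∸n+n≡m 3≤d ⟩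
      d                 ∎
      where open ≤-Reasoning

    d≤ : d ≤ 6 * t′ + 8
    d≤ = ≤-pred (begin-strict
      d                 ≡⟨ m∸n+n≡m 3≤d ⟨
      d ∸ 3 + 3         <⟨ +-monoˡ-< 3 d-3<6+6t′ ⟩
      6 + t′ * 6 + 3    ≡⟨ solve (t′ ∷ []) ⟩
      suc (6 * t′ + 8)  ∎)
      where open ≤-Reasoning

    3t′<q : 3 * t′ < q
    3t′<q = *-cancelˡ-< 4 (3 * t′) q (+-cancelˡ-< 4 _ _ (begin-strict
      4 + 4 * (3 * t′)  <⟨ m+n≤o⇒m≤o _ {1} (≤-reflexive (solve (t′ ∷ []))) ⟩
      2 * (6 * t′ + 3)  ≤⟨ *-monoʳ-≤ 2 d≥ ⟩
      2 * d             ≤⟨ 2d≤Δ ⟩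
      Δ                 <⟨ Δ<4+4q ⟩
      4 + 4 * q         ∎))
      where open ≤-Reasoning

    t′+D≤2q : t′ + suc (2 * t′) ≤ q + q
    t′+D≤2q = begin
      t′ + suc (2 * t′)  ≡⟨ solve (t′ ∷ []) ⟩
      suc (3 * t′)       ≤⟨ 3t′<q ⟩
      q                  ≤⟨ m≤m+n q q ⟩
      q + q              ∎
      where open ≤-Reasoning

    2q≡ : q + q ≡ t′ + B % D + suc (B / D) * D
    2q≡ = begin
      q + q                               ≡⟨ m+[n∸m]≡n t′+D≤2q ⟨
      (t′ + D) + B                        ≡⟨ cong ((t′ + D) +_) (m≡m%n+[m/n]*n B D) ⟩
      (t′ + D) + (B % D + (B / D) * D)    ≡⟨ +-interchange t′ D (B % D) ((B / D) * D) ⟩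
      t′ + B % D + suc (B / D) * D        ∎
      where
        open ≡-Reasoning
        +-interchange : ∀ a b c e → (a + b) + (c + e) ≡ (a + c) + (b + e)
        +-interchange = solve-∀

∃-admissible : ∀ {d Δ} → 3 ≤ d → 2 * d ≤ Δ → ∃₂ λ t′ r₀ → Admissible d Δ (Δ / 4) t′ r₀
∃-admissible {d} {Δ} 3≤d 2d≤Δ = (d ∸ 3) / 6 , choose-r₀ 3≤d 2d≤Δ
  (subst (_≤ Δ) (*-comm (Δ / 4) 4) (m/n*n≤m Δ 4))
  (subst (Δ <_) (cong (4 +_) (*-comm (Δ / 4) 4)) (m<n+[m/n]*n Δ 4))
  (m/n*n≤m (d ∸ 3) 6) (m<n+[m/n]*n (d ∸ 3) 6)

mainTheorem6 : (d k Δ : ℕ) → 4 ≤ d → 3 ≤ k → 2 * d ≤ Δ →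
    Σ ℕ (λ n → Σ (Graph n) (λ G →
    AvgDegreeAtMost G d × MaxDegreeAtMost G Δ × DiameterAtMost G k ×
    d * (Δ / 4) ^ (k ∸ 1) ≤ 8 * n))
mainTheorem6 d (suc (suc m)) Δ 4≤d (s≤s (s≤s _)) 2d≤Δ
  with t′ , r₀ , adm ← ∃-admissible (≤-trans (n≤1+n 3) 4≤d) 2d≤Δ =
  _ , graph , avgDegree {d} average , maxDegree hub≤Δ leaf≤Δ , diameter , order-≥ {d} order
  where
    open Gadget (Δ / 4) t′ r₀ m using (graph; avgDegree; maxDegree; diameter; order-≥)
    open Admissible adm
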